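{- Let $p(k)=324k^4 -216k^3 +84k^2 -16k-1$, $q(k)=324k^4 +216 k^3 +84k^2 +16k -1$, and $r(k)=324k^4 +648k^3 +516k^2 +192k +26$. For each integer $n \geq 4$, put $f(n)=\left[ \left(\sum_{k=n}^{\infty}\frac{1}{k^5} \right)^{ -1} \right]$. Then \begin{equation*} f(n)=\begin{cases} p(m), & \text{if } n=3m; \\ q(m), & \text{if } n=3m+1; \\ r(m), & \text{if } n=3m+2, \end{cases} \end{equation*} where $m$ is an integer.
   Context: For a real number $x$, $[x]$ denotes the greatest integer less than or equal to $x$. -}

module Defs where

open import Data.Nat as ℕ using (ℕ; zero; suc)
open import Data.Nat.Properties using (m^n≢0)
open import Data.Integer as ℤ using (ℤ; +_; -_)
open import Data.Rational using (ℚ; 0ℚ; 1ℚ; _/_; _+_; _*_; _≤_; _<_)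
open import Data.Product using (_×_; ∃-syntax)

p : ℤ → ℤ
p k = (+ 324) ℤ.* k ℤ.^ 4 ℤ.- (+ 216) ℤ.* k ℤ.^ 3 ℤ.+ (+ 84) ℤ.* k ℤ.^ 2 ℤ.- (+ 16) ℤ.* k ℤ.- + 1

q : ℤ → ℤ
q k = (+ 324) ℤ.* k ℤ.^ 4 ℤ.+ (+ 216) ℤ.* k ℤ.^ 3 ℤ.+ (+ 84) ℤ.* k ℤ.^ 2 ℤ.+ (+ 16) ℤ.* k ℤ.- + 1

r : ℤ → ℤ
r k = (+ 324) ℤ.* k ℤ.^ 4 ℤ.+ (+ 648) ℤ.* k ℤ.^ 3 ℤ.+ (+ 516) ℤ.* k ℤ.^ 2 ℤ.+ (+ 192) ℤ.* k ℤ.+ + 26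

-- 1 / k^5 as a rational (k = 0 gives 0; never used since n ≥ 4)
recip5 : ℕ → ℚ
recip5 zero = 0ℚ
recip5 (suc k) = (+ 1) / (suc k ℕ.^ 5)
  where instance _ = m^n≢0 (suc k) 5

tailPartial : ℕ → ℕ → ℚ
tailPartial n zero = 0ℚ
tailPartial n (suc M) = tailPartial n M + recip5 (n ℕ.+ M)

ℤtoℚ : ℤ → ℚ
ℤtoℚ z = z / 1

-- Writing S = Σ_{k≥n} 1/k^5 > 0 (the supremum of the increasing partial sums),
-- N = [1/S]  ⇔  N ≤ 1/S < N+1  ⇔  N·S ≤ 1 < (N+1)·S
--            ⇔  (∀ M, N·S_M ≤ 1) ∧ (∃ M, 1 < (N+1)·S_M).
IsFloorRecipTail : ℕ → ℤ → Set
IsFloorRecipTail n N =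
  ((M : ℕ) → ℤtoℚ N * tailPartial n M ≤ 1ℚ)
  × (∃[ M ] (1ℚ < ℤtoℚ (N ℤ.+ + 1) * tailPartial n M))

{-# OPTIONS --safe #-}
-- Put x = 2n − 1, G(n) = 36x⁴ + 120x² − 188 and S(n) = Σ_{k ≥ n} k⁻⁵. For n ≥ 4,
--   144 (x² + 12) / (G(n) (x² + 12) + 1880)  ≤  S(n)  ≤  144 / G(n),
-- because both bounds telescope: the upper bound U satisfies k⁻⁵ + U(k + 1) ≤ U(k) and the lower
-- bound the reverse inequality. After clearing denominators these are polynomial inequalities
-- whose coefficients, expanded around k = 4, already compare termwise. For n = 3m, 3m + 1, 3m + 2
-- one has G(n) = 144 N + c with N = p(m), q(m), r(m) and c = 112, 112, 64, so 1/S(n) lies between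
-- N + c/144 and N + (c + 31)/144 < N + 1. As only partial sums are available, the lower bound L is
-- used as Σ_{k=n}^{n+M−1} k⁻⁵ ≥ L(n) − L(n + M) with L(n + M) ≤ 1/(n + M) and M large.
module Submission where

open import Defs
open import Data.Nat using (ℕ; _≤_; _*_; _+_)
open import Data.Integer using (+_)
open import Data.Product using (_×_)

open import Data.Bool using (Bool; true; T; _∧_)
open import Data.Bool.Properties using (T-∧)
open import Data.List using (List; []; _∷_; map)
open import Data.Nat using (zero; suc; _<_; _^_; _∸_; _≤ᵇ_; NonZero; >-nonZero; z≤n; s≤s; z<s)
open import Data.Nat.Properties
  using (+-identityʳ; +-assoc; +-comm; +-suc; *-zeroʳ; *-identityˡ; *-identityʳ; *-comm; *-suc; *-distribʳ-+;
         ≤-refl; ≤-reflexive; ≤-trans; ≤-antisym; ≤ᵇ⇒≤; m≤m+n; m<n+m; +-mono-≤; +-mono-≤-<; +-monoʳ-<;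
         *-monoˡ-≤; *-monoʳ-≤; m*n≢0; module ≤-Reasoning)
open import Data.Nat.Tactic.RingSolver using (solve-∀)
open import Data.Integer as ℤ using (ℤ)
open import Data.Integer.Properties using (pos-+; pos-*)
open import Data.Integer.Solver using (module +-*-Solver)
open import Data.Rational as ℚ using (ℚ; 0ℚ; 1ℚ; NonNegative; toℚᵘ)
import Data.Rational.Properties as ℚ
open import Data.Rational.Unnormalised as ℚᵘ using (mkℚᵘ)
import Data.Rational.Unnormalised.Properties as ℚᵘ
open import Data.Product using (_,_)
open import Data.Unit using (tt)
open import Function using (Equivalence)
open import Relation.Binary.PropositionalEquality

-- Polynomials with natural coefficients, compared coefficientwise

infixl 6 _+ᶜ_
infixl 7 _*ᶜ_

_+ᶜ_ : List ℕ → List ℕ → List ℕ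
[]       +ᶜ bs       = bs
(a ∷ as) +ᶜ []       = a ∷ as
(a ∷ as) +ᶜ (b ∷ bs) = a + b ∷ as +ᶜ bs

_*ᶜ_ : List ℕ → List ℕ → List ℕ
[]       *ᶜ bs = []
(a ∷ as) *ᶜ bs = map (a *_) bs +ᶜ (0 ∷ as *ᶜ bs)

_^ᶜ_ : List ℕ → ℕ → List ℕ
as ^ᶜ zero  = 1 ∷ []
as ^ᶜ suc n = as *ᶜ as ^ᶜ n

_∘ᶜ_ : List ℕ → List ℕ → List ℕ
[]       ∘ᶜ bs = []
(a ∷ as) ∘ᶜ bs = (a ∷ []) +ᶜ bs *ᶜ (as ∘ᶜ bs)

_≤ᶜ_ : List ℕ → List ℕ → Bool
[]       ≤ᶜ bs       = true
(a ∷ as) ≤ᶜ []       = (a ≤ᵇ 0) ∧ (as ≤ᶜ [])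
(a ∷ as) ≤ᶜ (b ∷ bs) = (a ≤ᵇ b) ∧ (as ≤ᶜ bs)

hornerℤ : List ℕ → ℤ → ℤ
hornerℤ []       x = + 0
hornerℤ (a ∷ as) x = + a ℤ.+ x ℤ.* hornerℤ as x

-- Opaque, so that a goal mentioning a polynomial defined by horner stays folded and is matched
-- syntactically by ⟦_⟧ below: unfolding it would expand large literals one suc at a time.
opaque
  horner : List ℕ → ℕ → ℕ
  horner []       x = 0
  horner (a ∷ as) x = a + x * horner as x

  horner-+ᶜ : ∀ as bs x → horner (as +ᶜ bs) x ≡ horner as x + horner bs x
  horner-+ᶜ []       bs       x = refl
  horner-+ᶜ (a ∷ as) []       x = sym (+-identityʳ _)
  horner-+ᶜ (a ∷ as) (b ∷ bs) x = begin
    a + b + x * horner (as +ᶜ bs) x                ≡⟨ cong (λ t → a + b + x * t) (horner-+ᶜ as bs x) ⟩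
    a + b + x * (horner as x + horner bs x)       ≡⟨ lemma a b x (horner as x) (horner bs x) ⟩
    (a + x * horner as x) + (b + x * horner bs x) ∎
    where
    open ≡-Reasoning
    lemma : ∀ a b x u w → a + b + x * (u + w) ≡ (a + x * u) + (b + x * w)
    lemma = solve-∀

  horner-map : ∀ a bs x → horner (map (a *_) bs) x ≡ a * horner bs x
  horner-map a []       x = sym (*-zeroʳ a)
  horner-map a (b ∷ bs) x = begin
    a * b + x * horner (map (a *_) bs) x ≡⟨ cong (λ t → a * b + x * t) (horner-map a bs x) ⟩
    a * b + x * (a * horner bs x)        ≡⟨ lemma a b x (horner bs x) ⟩
    a * (b + x * horner bs x)            ∎
    where
    open ≡-Reasoning
    lemma : ∀ a b x w → a * b + x * (a * w) ≡ a * (b + x * w)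
    lemma = solve-∀

  horner-*ᶜ : ∀ as bs x → horner (as *ᶜ bs) x ≡ horner as x * horner bs x
  horner-*ᶜ []       bs x = refl
  horner-*ᶜ (a ∷ as) bs x = begin
    horner (map (a *_) bs +ᶜ (0 ∷ as *ᶜ bs)) x          ≡⟨ horner-+ᶜ (map (a *_) bs) (0 ∷ as *ᶜ bs) x ⟩
    horner (map (a *_) bs) x + x * horner (as *ᶜ bs) x  ≡⟨ cong₂ (λ u w → u + x * w) (horner-map a bs x)
                                                                                (horner-*ᶜ as bs x) ⟩
    a * horner bs x + x * (horner as x * horner bs x) ≡⟨ lemma a x (horner as x) (horner bs x) ⟩
    (a + x * horner as x) * horner bs x               ∎
    where
    open ≡-Reasoning
    lemma : ∀ a x u w → a * w + x * (u * w) ≡ (a + x * u) * w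
    lemma = solve-∀

  horner-^ᶜ : ∀ as n x → horner (as ^ᶜ n) x ≡ horner as x ^ n
  horner-^ᶜ as zero    x = cong suc (*-zeroʳ x)
  horner-^ᶜ as (suc n) x = trans (horner-*ᶜ as (as ^ᶜ n) x) (cong (horner as x *_) (horner-^ᶜ as n x))

  horner-const : ∀ c x → horner (c ∷ []) x ≡ c
  horner-const c x = trans (cong (λ t → c + t) (*-zeroʳ x)) (+-identityʳ c)

  horner-id : ∀ x → horner (0 ∷ 1 ∷ []) x ≡ x
  horner-id x = trans (cong (λ t → x * suc t) (*-zeroʳ x)) (*-identityʳ x)

  horner-∘ᶜ : ∀ as bs x → horner (as ∘ᶜ bs) x ≡ horner as (horner bs x)
  horner-∘ᶜ []       bs x = refl
  horner-∘ᶜ (a ∷ as) bs x = begin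
    horner ((a ∷ []) +ᶜ bs *ᶜ (as ∘ᶜ bs)) x             ≡⟨ horner-+ᶜ (a ∷ []) (bs *ᶜ (as ∘ᶜ bs)) x ⟩
    horner (a ∷ []) x + horner (bs *ᶜ (as ∘ᶜ bs)) x     ≡⟨ cong₂ _+_ (horner-const a x) (horner-*ᶜ bs (as ∘ᶜ bs) x) ⟩
    a + horner bs x * horner (as ∘ᶜ bs) x               ≡⟨ cong (λ t → a + horner bs x * t) (horner-∘ᶜ as bs x) ⟩
    a + horner bs x * horner as (horner bs x)           ∎
    where open ≡-Reasoning

  ≤ᶜ⇒horner-≤ : ∀ as bs → T (as ≤ᶜ bs) → ∀ x → horner as x ≤ horner bs x
  ≤ᶜ⇒horner-≤ []       bs       _ x = z≤n
  ≤ᶜ⇒horner-≤ (a ∷ as) []       h x with Equivalence.to T-∧ h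
  ... | a≤0 , as≤0 = +-mono-≤ (≤ᵇ⇒≤ a 0 a≤0)
    (≤-trans (*-monoʳ-≤ x (≤ᶜ⇒horner-≤ as [] as≤0 x)) (≤-reflexive (*-zeroʳ x)))
  ≤ᶜ⇒horner-≤ (a ∷ as) (b ∷ bs) h x with Equivalence.to T-∧ h
  ... | a≤b , as≤bs = +-mono-≤ (≤ᵇ⇒≤ a b a≤b) (*-monoʳ-≤ x (≤ᶜ⇒horner-≤ as bs as≤bs x))

  +-horner : ∀ as x → + horner as x ≡ hornerℤ as (+ x)
  +-horner []       x = refl
  +-horner (a ∷ as) x = trans (pos-+ a (x * horner as x))
    (cong (λ t → + a ℤ.+ t) (trans (pos-* x (horner as x)) (cong (λ t → + x ℤ.* t) (+-horner as x))))

infixl 6 _⊕_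
infixl 7 _⊗_
infixr 8 _↑_

data Expr : Set where
  var  : Expr
  con  : ℕ → Expr
  _⊕_  : Expr → Expr → Expr
  _⊗_  : Expr → Expr → Expr
  _↑_  : Expr → ℕ → Expr
  poly : List ℕ → Expr → Expr

⟦_⟧ : Expr → ℕ → ℕ
⟦ var       ⟧ x = x
⟦ con c     ⟧ x = c
⟦ e ⊕ f     ⟧ x = ⟦ e ⟧ x + ⟦ f ⟧ x
⟦ e ⊗ f     ⟧ x = ⟦ e ⟧ x * ⟦ f ⟧ x
⟦ e ↑ n     ⟧ x = ⟦ e ⟧ x ^ n
⟦ poly as e ⟧ x = horner as (⟦ e ⟧ x)

coefficients : Expr → List ℕ
coefficients var         = 0 ∷ 1 ∷ []
coefficients (con c)     = c ∷ []
coefficients (e ⊕ f)     = coefficients e +ᶜ coefficients f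
coefficients (e ⊗ f)     = coefficients e *ᶜ coefficients f
coefficients (e ↑ n)     = coefficients e ^ᶜ n
coefficients (poly as e) = as ∘ᶜ coefficients e

⟦⟧≡horner : ∀ e x → ⟦ e ⟧ x ≡ horner (coefficients e) x
⟦⟧≡horner var         x = sym (horner-id x)
⟦⟧≡horner (con c)     x = sym (horner-const c x)
⟦⟧≡horner (e ⊕ f)     x = trans (cong₂ _+_ (⟦⟧≡horner e x) (⟦⟧≡horner f x))
  (sym (horner-+ᶜ (coefficients e) (coefficients f) x))
⟦⟧≡horner (e ⊗ f)     x = trans (cong₂ _*_ (⟦⟧≡horner e x) (⟦⟧≡horner f x))
  (sym (horner-*ᶜ (coefficients e) (coefficients f) x))
⟦⟧≡horner (e ↑ n)     x = trans (cong (_^ n) (⟦⟧≡horner e x)) (sym (horner-^ᶜ (coefficients e) n x))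
⟦⟧≡horner (poly as e) x = trans (cong (horner as) (⟦⟧≡horner e x)) (sym (horner-∘ᶜ as (coefficients e) x))

poly-≤ : ∀ e f → T (coefficients e ≤ᶜ coefficients f) → ∀ x → ⟦ e ⟧ x ≤ ⟦ f ⟧ x
poly-≤ e f e≤f x = subst₂ _≤_ (sym (⟦⟧≡horner e x)) (sym (⟦⟧≡horner f x))
  (≤ᶜ⇒horner-≤ (coefficients e) (coefficients f) e≤f x)

poly-≡ : ∀ e f → T (coefficients e ≤ᶜ coefficients f ∧ coefficients f ≤ᶜ coefficients e) →
         ∀ x → ⟦ e ⟧ x ≡ ⟦ f ⟧ x
poly-≡ e f h x with Equivalence.to T-∧ h
... | e≤f , f≤e = ≤-antisym (poly-≤ e f e≤f x) (poly-≤ f e f≤e x)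

infix 7 _÷_

-- Opaque, so that a and d can be inferred from a ÷ d; the normalising ℚ._/_ would hide them.
opaque
  _÷_ : ℕ → (d : ℕ) → .{{NonZero d}} → ℚ
  a ÷ d = + a ℚ./ d

  instance
    ÷-nonNeg : ∀ {a d} .{{_ : NonZero d}} → NonNegative (a ÷ d)
    ÷-nonNeg {a} {d} = ℚ.normalize-nonNeg a d

  toℚᵘ-÷ : ∀ a d .{{_ : NonZero d}} → toℚᵘ (a ÷ d) ℚᵘ.≃ (+ a) ℚᵘ./ d
  toℚᵘ-÷ a (suc d) = ℚ.toℚᵘ-fromℚᵘ (mkℚᵘ (+ a) d)

  ℤtoℚ-+ : ∀ n → ℤtoℚ (+ n) ≡ n ÷ 1
  ℤtoℚ-+ n = refl

  recip5-suc : ∀ k → recip5 (suc k) ≡ 1 ÷ (suc k ^ 5)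
  recip5-suc k = refl

  1ℚ≡1÷1 : 1ℚ ≡ 1 ÷ 1
  1ℚ≡1÷1 = refl

÷-cong : ∀ {a b c d} .{{_ : NonZero b}} .{{_ : NonZero d}} → a ≡ c → b ≡ d → a ÷ b ≡ c ÷ d
÷-cong refl refl = refl

÷-+ : ∀ a b c d .{{_ : NonZero b}} .{{_ : NonZero d}} →
      a ÷ b ℚ.+ c ÷ d ≡ _÷_ (a * d + c * b) (b * d) {{m*n≢0 b d}}
÷-+ a b@(suc _) c d@(suc _) = ℚ.toℚᵘ-injective (ℚᵘ.≃-trans (ℚ.toℚᵘ-homo-+ (a ÷ b) (c ÷ d))
  (ℚᵘ.≃-trans (ℚᵘ.+-cong (toℚᵘ-÷ a b) (toℚᵘ-÷ c d))
  (ℚᵘ.≃-trans (ℚᵘ.≃-reflexive (cong (ℚᵘ._/ (b * d)) numerator)) (ℚᵘ.≃-sym (toℚᵘ-÷ _ (b * d))))))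
  where
  numerator : + a ℤ.* + d ℤ.+ + c ℤ.* + b ≡ + (a * d + c * b)
  numerator = sym (trans (pos-+ (a * d) (c * b)) (cong₂ ℤ._+_ (pos-* a d) (pos-* c b)))

÷-* : ∀ a b c d .{{_ : NonZero b}} .{{_ : NonZero d}} →
      (a ÷ b) ℚ.* (c ÷ d) ≡ _÷_ (a * c) (b * d) {{m*n≢0 b d}}
÷-* a b@(suc _) c d@(suc _) = ℚ.toℚᵘ-injective (ℚᵘ.≃-trans (ℚ.toℚᵘ-homo-* (a ÷ b) (c ÷ d))
  (ℚᵘ.≃-trans (ℚᵘ.*-cong (toℚᵘ-÷ a b) (toℚᵘ-÷ c d))
  (ℚᵘ.≃-trans (ℚᵘ.≃-reflexive (cong (ℚᵘ._/ (b * d)) (sym (pos-* a c)))) (ℚᵘ.≃-sym (toℚᵘ-÷ _ (b * d))))))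

÷≤÷ : ∀ {a b c d} .{{_ : NonZero b}} .{{_ : NonZero d}} → a * d ≤ c * b → a ÷ b ℚ.≤ c ÷ d
÷≤÷ {a} {b@(suc _)} {c} {d@(suc _)} ad≤cb = ℚ.toℚᵘ-cancel-≤
  (ℚᵘ.≤-respˡ-≃ (ℚᵘ.≃-sym (toℚᵘ-÷ a b)) (ℚᵘ.≤-respʳ-≃ (ℚᵘ.≃-sym (toℚᵘ-÷ c d))
    (ℚᵘ.*≤* (subst₂ ℤ._≤_ (pos-* a d) (pos-* c b) (ℤ.+≤+ ad≤cb)))))

÷<÷ : ∀ {a b c d} .{{_ : NonZero b}} .{{_ : NonZero d}} → a * d < c * b → a ÷ b ℚ.< c ÷ d
÷<÷ {a} {b@(suc _)} {c} {d@(suc _)} ad<cb = ℚ.toℚᵘ-cancel-<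
  (ℚᵘ.<-respˡ-≃ (ℚᵘ.≃-sym (toℚᵘ-÷ a b)) (ℚᵘ.<-respʳ-≃ (ℚᵘ.≃-sym (toℚᵘ-÷ c d))
    (ℚᵘ.*<* (subst₂ ℤ._<_ (pos-* a d) (pos-* c b) (ℤ.+<+ ad<cb)))))

÷1-*-÷ : ∀ a b d .{{_ : NonZero d}} → (a ÷ 1) ℚ.* (b ÷ d) ≡ (a * b) ÷ d
÷1-*-÷ a b d = trans (÷-* a 1 b d) (÷-cong {{m*n≢0 1 d}} refl (*-identityˡ d))

1+÷ : ∀ a d .{{_ : NonZero d}} → 1 ÷ 1 ℚ.+ a ÷ d ≡ (d + a) ÷ d
1+÷ a d = trans (÷-+ 1 1 a d) (÷-cong {{m*n≢0 1 d}} (cong₂ _+_ (*-identityˡ d) (*-identityʳ a)) (*-identityˡ d))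

÷≤1 : ∀ {a d} .{{_ : NonZero d}} → a ≤ d → a ÷ d ℚ.≤ 1 ÷ 1
÷≤1 {a} {d} a≤d = ÷≤÷ (subst₂ _≤_ (sym (*-identityʳ a)) (sym (*-identityˡ d)) a≤d)

÷+÷≤÷ : ∀ {a b c d e f} .{{_ : NonZero b}} .{{_ : NonZero d}} .{{_ : NonZero f}} →
        (a * d + c * b) * f ≤ e * (b * d) → a ÷ b ℚ.+ c ÷ d ℚ.≤ e ÷ f
÷+÷≤÷ {a} {b} {c} {d} h = ℚ.≤-trans (ℚ.≤-reflexive (÷-+ a b c d)) (÷≤÷ {{m*n≢0 b d}} h)

÷≤÷+÷ : ∀ {a b c d e f} .{{_ : NonZero b}} .{{_ : NonZero d}} .{{_ : NonZero f}} →
        e * (b * d) ≤ (a * d + c * b) * f → e ÷ f ℚ.≤ a ÷ b ℚ.+ c ÷ d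
÷≤÷+÷ {a} {b} {c} {d} h = ℚ.≤-trans (÷≤÷ {{_}} {{m*n≢0 b d}} h) (ℚ.≤-reflexive (sym (÷-+ a b c d)))

+-cancelʳ-< : ∀ r {p q} → p ℚ.+ r ℚ.< q ℚ.+ r → p ℚ.< q
+-cancelʳ-< r {p} {q} p+r<q+r = subst₂ ℚ._<_ (p+r-r≡p p) (p+r-r≡p q) (ℚ.+-monoˡ-< (ℚ.- r) p+r<q+r)
  where
  p+r-r≡p : ∀ p → p ℚ.+ r ℚ.- r ≡ p
  p+r-r≡p p = trans (ℚ.+-assoc p r (ℚ.- r)) (trans (cong (p ℚ.+_) (ℚ.+-inverseʳ r)) (ℚ.+-identityʳ p))

-- Telescoping bounds for partial sums

sumFrom : (ℕ → ℚ) → ℕ → ℕ → ℚ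
sumFrom f n zero    = 0ℚ
sumFrom f n (suc M) = sumFrom f n M ℚ.+ f (n + M)

tailPartial≡sumFrom : ∀ n M → tailPartial n M ≡ sumFrom recip5 n M
tailPartial≡sumFrom n zero    = refl
tailPartial≡sumFrom n (suc M) = cong (ℚ._+ recip5 (n + M)) (tailPartial≡sumFrom n M)

-- Super- and subsolutions of the recurrence S k = f k + S (suc k) obeyed by the tails of Σ f.
IsSupersolution IsSubsolution : (ℕ → ℚ) → ℕ → (ℕ → ℚ) → Set
IsSupersolution f n U = ∀ k → n ≤ k → f k ℚ.+ U (suc k) ℚ.≤ U k
IsSubsolution   f n L = ∀ k → n ≤ k → L k ℚ.≤ f k ℚ.+ L (suc k)

module _ (f : ℕ → ℚ) (n : ℕ) where
  open ℚ.≤-Reasoning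

  supersolution-telescopes : ∀ {U} → IsSupersolution f n U → ∀ M → sumFrom f n M ℚ.+ U (n + M) ℚ.≤ U n
  supersolution-telescopes {U} super zero = ℚ.≤-reflexive (trans (ℚ.+-identityˡ _) (cong U (+-identityʳ n)))
  supersolution-telescopes {U} super (suc M) = begin
    S ℚ.+ f (n + M) ℚ.+ U (n + suc M)      ≡⟨ cong (λ k → S ℚ.+ f (n + M) ℚ.+ U k) (+-suc n M) ⟩
    S ℚ.+ f (n + M) ℚ.+ U (suc (n + M))    ≡⟨ ℚ.+-assoc S (f (n + M)) (U (suc (n + M))) ⟩
    S ℚ.+ (f (n + M) ℚ.+ U (suc (n + M)))  ≤⟨ ℚ.+-monoʳ-≤ S (super (n + M) (m≤m+n n M)) ⟩
    S ℚ.+ U (n + M)                        ≤⟨ supersolution-telescopes super M ⟩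
    U n                                    ∎
    where
    S : ℚ
    S = sumFrom f n M

  subsolution-telescopes : ∀ {L} → IsSubsolution f n L → ∀ M → L n ℚ.≤ sumFrom f n M ℚ.+ L (n + M)
  subsolution-telescopes {L} sub zero = ℚ.≤-reflexive (sym (trans (ℚ.+-identityˡ _) (cong L (+-identityʳ n))))
  subsolution-telescopes {L} sub (suc M) = begin
    L n                                    ≤⟨ subsolution-telescopes sub M ⟩
    S ℚ.+ L (n + M)                        ≤⟨ ℚ.+-monoʳ-≤ S (sub (n + M) (m≤m+n n M)) ⟩
    S ℚ.+ (f (n + M) ℚ.+ L (suc (n + M)))  ≡⟨ ℚ.+-assoc S (f (n + M)) (L (suc (n + M))) ⟨
    S ℚ.+ f (n + M) ℚ.+ L (suc (n + M))    ≡⟨ cong (λ k → S ℚ.+ f (n + M) ℚ.+ L k) (+-suc n M) ⟨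
    S ℚ.+ f (n + M) ℚ.+ L (n + suc M)      ∎
    where
    S : ℚ
    S = sumFrom f n M

Gᶜ hᶜ : List ℕ
Gᶜ = 92128 ∷ 102144 ∷ 42816 ∷ 8064 ∷ 576 ∷ []
hᶜ = 61 ∷ 28 ∷ 4 ∷ []

-- At the index k = v + 4, with x = 2k − 1 = 2v + 7:  G v = 36x⁴ + 120x² − 188 and h v = x² + 12.
G h D : ℕ → ℕ
G = horner Gᶜ
h = horner hᶜ
D v = G v * h v + 1880

Dᴱ : Expr → Expr
Dᴱ e = poly Gᶜ e ⊗ poly hᶜ e ⊕ con 1880

instance
  G-nonZero : ∀ {v} → NonZero (G v)
  G-nonZero {v} = >-nonZero (poly-≤ (con 1) (poly Gᶜ var) tt v)

  D-nonZero : ∀ {v} → NonZero (D v)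
  D-nonZero {v} = >-nonZero (poly-≤ (con 1) (Dᴱ var) tt v)

-- Only the indices k ≥ 4 matter; below that k ∸ 4 truncates to 0.
upper lower : ℕ → ℚ
upper k = 144 ÷ G (k ∸ 4)
lower k = (144 * h (k ∸ 4)) ÷ D (k ∸ 4)

4≤-elim : {P : ℕ → Set} → (∀ v → P (4 + v)) → ∀ k → 4 ≤ k → P k
4≤-elim P[4+v] k (s≤s (s≤s (s≤s (s≤s _)))) = P[4+v] _

upper-step-cleared : ∀ v → (1 * G (1 + v) + 144 * (4 + v) ^ 5) * G v ≤ 144 * ((4 + v) ^ 5 * G (1 + v))
upper-step-cleared = poly-≤
  ((con 1 ⊗ poly Gᶜ (con 1 ⊕ var) ⊕ con 144 ⊗ (con 4 ⊕ var) ↑ 5) ⊗ poly Gᶜ var)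
  (con 144 ⊗ ((con 4 ⊕ var) ↑ 5 ⊗ poly Gᶜ (con 1 ⊕ var))) tt

lower-step-cleared : ∀ v →
  144 * h v * ((4 + v) ^ 5 * D (1 + v)) ≤ (1 * D (1 + v) + 144 * h (1 + v) * (4 + v) ^ 5) * D v
lower-step-cleared = poly-≤
  (con 144 ⊗ poly hᶜ var ⊗ ((con 4 ⊕ var) ↑ 5 ⊗ Dᴱ (con 1 ⊕ var)))
  ((con 1 ⊗ Dᴱ (con 1 ⊕ var) ⊕ con 144 ⊗ poly hᶜ (con 1 ⊕ var) ⊗ (con 4 ⊕ var) ↑ 5) ⊗ Dᴱ var) tt

upper-supersolution : IsSupersolution recip5 4 upper
upper-supersolution = 4≤-elim λ v →
  subst (λ r → r ℚ.+ upper (5 + v) ℚ.≤ upper (4 + v)) (sym (recip5-suc (3 + v))) (÷+÷≤÷ (upper-step-cleared v))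

lower-subsolution : IsSubsolution recip5 4 lower
lower-subsolution = 4≤-elim λ v →
  subst (λ r → lower (4 + v) ℚ.≤ r ℚ.+ lower (5 + v)) (sym (recip5-suc (3 + v))) (÷≤÷+÷ (lower-step-cleared v))

lower≤1/k : ∀ v → lower (4 + v) ℚ.≤ 1 ÷ (4 + v)
lower≤1/k v = ÷≤÷ (poly-≤ (con 144 ⊗ poly hᶜ var ⊗ (con 4 ⊕ var)) (con 1 ⊗ Dᴱ var) tt v)

tailPartial≤upper : ∀ n M → 4 ≤ n → tailPartial n M ℚ.≤ upper n
tailPartial≤upper n M 4≤n = begin
  tailPartial n M                        ≡⟨ tailPartial≡sumFrom n M ⟩
  sumFrom recip5 n M                     ≡⟨ ℚ.+-identityʳ _ ⟨
  sumFrom recip5 n M ℚ.+ 0ℚ              ≤⟨ ℚ.+-monoʳ-≤ (sumFrom recip5 n M) (ℚ.nonNegative⁻¹ (upper (n + M))) ⟩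
  sumFrom recip5 n M ℚ.+ upper (n + M)   ≤⟨ supersolution-telescopes recip5 n
                                              (λ k n≤k → upper-supersolution k (≤-trans 4≤n n≤k)) M ⟩
  upper n                                ∎
  where open ℚ.≤-Reasoning

lower≤tailPartial+lower : ∀ n M → 4 ≤ n → lower n ℚ.≤ tailPartial n M ℚ.+ lower (n + M)
lower≤tailPartial+lower n M 4≤n = subst (λ s → lower n ℚ.≤ s ℚ.+ lower (n + M)) (sym (tailPartial≡sumFrom n M))
  (subsolution-telescopes recip5 n (λ k n≤k → lower-subsolution k (≤-trans 4≤n n≤k)) M)

m<n⇒o*m<k⇒[k+o]*m<n*k : ∀ {m n o k} → m < n → o * m < k → (k + o) * m < n * k
m<n⇒o*m<k⇒[k+o]*m<n*k {m} {n} {o} {k} m<n om<k = begin-strict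
  (k + o) * m    ≡⟨ *-distribʳ-+ m k o ⟩
  k * m + o * m  <⟨ +-monoʳ-< (k * m) om<k ⟩
  k * m + k      ≡⟨ +-comm (k * m) k ⟩
  k + k * m      ≡⟨ *-suc k m ⟨
  k * suc m      ≤⟨ *-monoʳ-≤ k m<n ⟩
  k * n          ≡⟨ *-comm k n ⟩
  n * k          ∎
  where open ≤-Reasoning

D<[N+1]*144h : ∀ v N c → c ≤ 112 → 144 * N + c ≡ G v → D v < (N + 1) * (144 * h v)
D<[N+1]*144h v N c c≤112 144N+c≡G = begin-strict
  G v * h v + 1880                        ≡⟨ cong (λ g → g * h v + 1880) 144N+c≡G ⟨
  (144 * N + c) * h v + 1880              ≡⟨ regroup (144 * N) c (h v) ⟩
  144 * N * h v + (c * h v + 1880)        <⟨ +-monoʳ-< (144 * N * h v) (+-mono-≤-< (*-monoˡ-≤ (h v) c≤112) 1880<32h) ⟩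
  144 * N * h v + (112 * h v + 32 * h v)  ≡⟨ expand N (h v) ⟩
  (N + 1) * (144 * h v)                   ∎
  where
  open ≤-Reasoning
  1880<32h : 1880 < 32 * h v
  1880<32h = poly-≤ (con 1881) (con 32 ⊗ poly hᶜ var) tt v
  regroup : ∀ a c x → (a + c) * x + 1880 ≡ a * x + (c * x + 1880)
  regroup a c x = trans (cong (_+ 1880) (*-distribʳ-+ x a c)) (+-assoc (a * x) (c * x) 1880)
  expand : ∀ N x → 144 * N * x + (112 * x + 32 * x) ≡ (N + 1) * (144 * x)
  expand = solve-∀

N*tailPartial≤1 : ∀ v N → 144 * N ≤ G v → ∀ M → ℤtoℚ (+ N) ℚ.* tailPartial (4 + v) M ℚ.≤ 1ℚ
N*tailPartial≤1 v N 144N≤G M = begin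
  ℤtoℚ (+ N) ℚ.* tailPartial (4 + v) M  ≡⟨ cong (ℚ._* tailPartial (4 + v) M) (ℤtoℚ-+ N) ⟩
  (N ÷ 1) ℚ.* tailPartial (4 + v) M     ≤⟨ ℚ.*-monoˡ-≤-nonNeg (N ÷ 1) (tailPartial≤upper (4 + v) M (m≤m+n 4 v)) ⟩
  (N ÷ 1) ℚ.* (144 ÷ G v)               ≡⟨ ÷1-*-÷ N 144 (G v) ⟩
  (N * 144) ÷ G v                       ≤⟨ ÷≤1 (≤-trans (≤-reflexive (*-comm N 144)) 144N≤G) ⟩
  1 ÷ 1                                 ≡⟨ 1ℚ≡1÷1 ⟨
  1ℚ                                    ∎
  where open ℚ.≤-Reasoning

-- With M = (N + 1) · D v the remainder ν · lower (n + M) ≤ (N + 1) / (n + M) is below the excess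
-- ν · lower n − 1 ≥ 1 / D v, where ν = N + 1 and n = 4 + v.
1<[N+1]*tailPartial : ∀ v N → D v < (N + 1) * (144 * h v) →
                      1ℚ ℚ.< ℤtoℚ (+ N ℤ.+ + 1) ℚ.* tailPartial (4 + v) ((N + 1) * D v)
1<[N+1]*tailPartial v N D<[N+1]*144h = +-cancelʳ-< ε (begin-strict
  1ℚ ℚ.+ ε                                          ≡⟨ cong₂ ℚ._+_ 1ℚ≡1÷1 (÷1-*-÷ (N + 1) 1 (n + M)) ⟩
  1 ÷ 1 ℚ.+ ((N + 1) * 1) ÷ (n + M)                 ≡⟨ 1+÷ ((N + 1) * 1) (n + M) ⟩
  (n + M + (N + 1) * 1) ÷ (n + M)                   <⟨ ÷<÷ (m<n⇒o*m<k⇒[k+o]*m<n*k D<[N+1]*144h [N+1]*1*D<n+M) ⟩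
  ((N + 1) * (144 * h v)) ÷ D v                     ≡⟨ ÷1-*-÷ (N + 1) (144 * h v) (D v) ⟨
  ν ℚ.* lower n                                     ≤⟨ ℚ.*-monoˡ-≤-nonNeg ν (lower≤tailPartial+lower n M (m≤m+n 4 v)) ⟩
  ν ℚ.* (tailPartial n M ℚ.+ lower (n + M))         ≡⟨ ℚ.*-distribˡ-+ ν (tailPartial n M) (lower (n + M)) ⟩
  ν ℚ.* tailPartial n M ℚ.+ ν ℚ.* lower (n + M)     ≤⟨ ℚ.+-monoʳ-≤ (ν ℚ.* tailPartial n M)
                                                         (ℚ.*-monoˡ-≤-nonNeg ν (lower≤1/k (v + M))) ⟩
  ν ℚ.* tailPartial n M ℚ.+ ε                       ≡⟨ cong (λ x → x ℚ.* tailPartial n M ℚ.+ ε) (ℤtoℚ-+ (N + 1)) ⟨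
  ℤtoℚ (+ N ℤ.+ + 1) ℚ.* tailPartial n M ℚ.+ ε      ∎)
  where
  open ℚ.≤-Reasoning
  n M : ℕ
  n = 4 + v
  M = (N + 1) * D v
  ν ε : ℚ
  ν = (N + 1) ÷ 1
  ε = ν ℚ.* (1 ÷ (n + M))
  [N+1]*1*D<n+M : (N + 1) * 1 * D v < n + M
  [N+1]*1*D<n+M = subst (_< n + M) (cong (_* D v) (sym (*-identityʳ (N + 1)))) (m<n+m M {n} z<s)

isFloorRecipTail-criterion : ∀ v N c → c ≤ 112 → 144 * N + c ≡ G v → IsFloorRecipTail (4 + v) (+ N)
isFloorRecipTail-criterion v N c c≤112 144N+c≡G =
  N*tailPartial≤1 v N (subst (144 * N ≤_) 144N+c≡G (m≤m+n (144 * N) c)) ,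
  ((N + 1) * D v , 1<[N+1]*tailPartial v N (D<[N+1]*144h v N c c≤112 144N+c≡G))

-- The three residue classes of n modulo 3

Pᶜ Qᶜ Rᶜ : List ℕ
Pᶜ = 3759 ∷ 8096 ∷ 6564 ∷ 2376 ∷ 324 ∷ []
Qᶜ = 639 ∷ 2128 ∷ 2676 ∷ 1512 ∷ 324 ∷ []
Rᶜ = 1706 ∷ 4464 ∷ 4404 ∷ 1944 ∷ 324 ∷ []

module _ where
  open +-*-Solver using (Polynomial; solve; _:=_; con; _:+_; _:-_; _:*_; _:^_)

  hornerᴾ : ∀ {n} → List ℕ → Polynomial n → Polynomial n
  hornerᴾ []       x = con (+ 0)
  hornerᴾ (a ∷ as) x = con (+ a) :+ x :* hornerᴾ as x

  pᴾ qᴾ rᴾ : ∀ {n} → Polynomial n → Polynomial n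
  pᴾ k = con (+ 324) :* k :^ 4 :- con (+ 216) :* k :^ 3 :+ con (+ 84) :* k :^ 2 :- con (+ 16) :* k :- con (+ 1)
  qᴾ k = con (+ 324) :* k :^ 4 :+ con (+ 216) :* k :^ 3 :+ con (+ 84) :* k :^ 2 :+ con (+ 16) :* k :- con (+ 1)
  rᴾ k = con (+ 324) :* k :^ 4 :+ con (+ 648) :* k :^ 3 :+ con (+ 516) :* k :^ 2 :+ con (+ 192) :* k :+ con (+ 26)

  p[2+s] : ∀ s → p (+ (2 + s)) ≡ + horner Pᶜ s
  p[2+s] s = trans (solve 1 (λ k → pᴾ (con (+ 2) :+ k) := hornerᴾ Pᶜ k) refl (+ s)) (sym (+-horner Pᶜ s))

  q[1+s] : ∀ s → q (+ (1 + s)) ≡ + horner Qᶜ s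
  q[1+s] s = trans (solve 1 (λ k → qᴾ (con (+ 1) :+ k) := hornerᴾ Qᶜ k) refl (+ s)) (sym (+-horner Qᶜ s))

  r[1+s] : ∀ s → r (+ (1 + s)) ≡ + horner Rᶜ s
  r[1+s] s = trans (solve 1 (λ k → rᴾ (con (+ 1) :+ k) := hornerᴾ Rᶜ k) refl (+ s)) (sym (+-horner Rᶜ s))

G[3s+2] : ∀ s → 144 * horner Pᶜ s + 112 ≡ G (3 * s + 2)
G[3s+2] = poly-≡ (con 144 ⊗ poly Pᶜ var ⊕ con 112) (poly Gᶜ (con 3 ⊗ var ⊕ con 2)) tt

G[3s] : ∀ s → 144 * horner Qᶜ s + 112 ≡ G (3 * s)
G[3s] = poly-≡ (con 144 ⊗ poly Qᶜ var ⊕ con 112) (poly Gᶜ (con 3 ⊗ var)) tt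

G[3s+1] : ∀ s → 144 * horner Rᶜ s + 64 ≡ G (3 * s + 1)
G[3s+1] = poly-≡ (con 144 ⊗ poly Rᶜ var ⊕ con 64) (poly Gᶜ (con 3 ⊗ var ⊕ con 1)) tt

floor-3m : ∀ m → 4 ≤ 3 * m → IsFloorRecipTail (3 * m) (p (+ m))
floor-3m zero          ()
floor-3m (suc zero)    (s≤s (s≤s (s≤s ())))
floor-3m (suc (suc s)) _ = subst₂ IsFloorRecipTail (index s) (sym (p[2+s] s))
  (isFloorRecipTail-criterion (3 * s + 2) (horner Pᶜ s) 112 ≤-refl (G[3s+2] s))
  where
  index : ∀ s → 4 + (3 * s + 2) ≡ 3 * (2 + s)
  index = solve-∀

floor-3m+1 : ∀ m → 4 ≤ 3 * m + 1 → IsFloorRecipTail (3 * m + 1) (q (+ m))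
floor-3m+1 zero    (s≤s ())
floor-3m+1 (suc s) _ = subst₂ IsFloorRecipTail (index s) (sym (q[1+s] s))
  (isFloorRecipTail-criterion (3 * s) (horner Qᶜ s) 112 ≤-refl (G[3s] s))
  where
  index : ∀ s → 4 + 3 * s ≡ 3 * (1 + s) + 1
  index = solve-∀

floor-3m+2 : ∀ m → 4 ≤ 3 * m + 2 → IsFloorRecipTail (3 * m + 2) (r (+ m))
floor-3m+2 zero    (s≤s (s≤s ()))
floor-3m+2 (suc s) _ = subst₂ IsFloorRecipTail (index s) (sym (r[1+s] s))
  (isFloorRecipTail-criterion (3 * s + 1) (horner Rᶜ s) 64 (≤ᵇ⇒≤ 64 112 tt) (G[3s+1] s))
  where
  index : ∀ s → 4 + (3 * s + 1) ≡ 3 * (1 + s) + 2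
  index = solve-∀

theorem3p4 : (m : ℕ)
    → (4 ≤ 3 * m → IsFloorRecipTail (3 * m) (p (+ m)))
    × (4 ≤ 3 * m + 1 → IsFloorRecipTail (3 * m + 1) (q (+ m)))
    × (4 ≤ 3 * m + 2 → IsFloorRecipTail (3 * m + 2) (r (+ m)))
theorem3p4 m = floor-3m m , floor-3m+1 m , floor-3m+2 m
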